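{- Let $\mathcal{C}=\{c_1,\ldots,c_m\}$ be a collection of cliques with graph union $U$ on vertex set $V$. Let $\mathcal{I}_P$ be the set of all path-intersecting families $\mathcal{F}\subseteq\{J\subseteq\{1,\ldots,m\}:\Gamma_J\neq\emptyset\}$. Then for every integer $k\ge 1$, the number of sets $H\subseteq V$ with $|H|=k$ such that $U[H]$ is connected equals the coefficient of $x^k$ in \[ \sum_{\mathcal{F}\in\mathcal{I}_P}\ \prod_{J\in\mathcal{F}}\left[(1+x)^{\gamma_J}-1\right]. \]
   Context: A clique is identified with its vertex set. The graph union $U$ of $c_1,\ldots,c_m$ has vertex set $V=\bigcup_j c_j$, and distinct $u,v\in V$ are adjacent iff $u,v\in c_j$ for some $j$. For $J\subseteq\{1,\ldots,m\}$, $\Gamma_J$ is the set of $v\in V$ with $\{j:v\in c_j\}=J$, and $\gamma_J=|\Gamma_J|$. A collection $\mathcal{F}$ of sets is path-intersecting if for any $A,B\in\mathcal{F}$ there is a sequence $A=J_1,\ldots,J_\ell=B$ of members of $\mathcal{F}$ with $J_i\cap J_{i+1}\neq\emptyset$ for all $i$. -}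

module Defs where

open import Data.Nat using (ℕ; zero; suc; _+_; _*_; _∸_; _≟_)
open import Data.Bool using (Bool; true; false)
open import Data.Fin using (Fin)
open import Data.Fin.Subset using (Subset; _∈_; _∉_; _⊆_; _∩_; Nonempty; ∣_∣)
open import Data.Vec using (Vec; []; _∷_; tabulate)
open import Data.List using (List; []; _∷_; map; _++_; filter; length; foldr; allFin)
import Data.List.Membership.Propositional as LM
open import Data.Product using (Σ; ∃; _×_; _,_)
open import Relation.Nullary using (¬_; Dec; yes; no; does)
open import Relation.Unary using (Pred; Decidable)
open import Relation.Binary.PropositionalEquality using (_≡_)
open import Data.Fin.Subset.Properties using (_∈?_; _⊆?_)
open import Data.Fin.Properties using (any?; all?)
open import Relation.Nullary.Decidable using (_×-dec_; _→-dec_; ¬?)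
open import Data.Bool.Properties using () renaming (_≟_ to _≟B_)
import Data.Vec.Properties as VP
import Data.Nat.Properties as NP

Cliques : ℕ → ℕ → Set
Cliques m n = Fin m → Subset n

module _ {m n : ℕ} (c : Cliques m n) where

  InV : Fin n → Set
  InV v = ∃ λ j → v ∈ c j

  SubsetOfV : Subset n → Set
  SubsetOfV H = ∀ v → v ∈ H → InV v

  Adj : Fin n → Fin n → Set
  Adj u v = ¬ (u ≡ v) × ∃ λ j → u ∈ c j × v ∈ c j

  data Walk (H : Subset n) : Fin n → Fin n → Set where
    here  : ∀ {u} → u ∈ H → Walk H u u
    step  : ∀ {u w v} → u ∈ H → Adj u w → Walk H w v → Walk H u v

  Connected : Subset n → Set
  Connected H = ∀ u v → u ∈ H → v ∈ H → Walk H u v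

  membership : Fin n → Subset m
  membership v = tabulate (λ j → does (v ∈? c j))

  InΓ : Subset m → Fin n → Set
  InΓ J v = InV v × membership v ≡ J

module _ {m n : ℕ} (c : Cliques m n) where

  inΓ? : (J : Subset m) → Decidable (InΓ c J)
  inΓ? J v = any? (λ j → v ∈? c j) ×-dec VP.≡-dec _≟B_ (membership c v) J

  γ : Subset m → ℕ
  γ J = length (filter (inΓ? J) (allFin n))

-- Path-intersecting families (a family is a list of distinct subsets of Fin m)

module _ {m : ℕ} (F : List (Subset m)) where
  open LM using () renaming (_∈_ to _∈L_)

  data Chain : Subset m → Subset m → Set where
    single : ∀ {A} → A ∈L F → Chain A A
    cons   : ∀ {A C B} → A ∈L F → Nonempty (A ∩ C) → Chain C B → Chain A B

  PathIntersecting : Set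
  PathIntersecting = ∀ A B → A ∈L F → B ∈L F → Chain A B

allSubsets : (k : ℕ) → List (Subset k)
allSubsets zero = [] ∷ []
allSubsets (suc k) = map (true ∷_) (allSubsets k) ++ map (false ∷_) (allSubsets k)

sublists : ∀ {A : Set} → List A → List (List A)
sublists [] = [] ∷ []
sublists (x ∷ xs) = map (x ∷_) (sublists xs) ++ sublists xs

-- Polynomials with ℕ coefficients, as coefficient functions ℕ → ℕ
-- (coefficient of x^i is p i).

Poly : Set
Poly = ℕ → ℕ

sumTo : ℕ → (ℕ → ℕ) → ℕ
sumTo zero f = f zero
sumTo (suc k) f = sumTo k f + f (suc k)

pzero : Poly
pzero _ = 0

pone : Poly
pone zero = 1
pone (suc _) = 0

_⊕_ : Poly → Poly → Poly
(p ⊕ q) i = p i + q i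

_⊛_ : Poly → Poly → Poly
(p ⊛ q) k = sumTo k (λ i → p i * q (k ∸ i))

onePlusX : Poly
onePlusX zero = 1
onePlusX (suc zero) = 1
onePlusX (suc (suc _)) = 0

_^P_ : Poly → ℕ → Poly
p ^P zero = pone
p ^P suc e = p ⊛ (p ^P e)

-- p - 1  (only used for p with constant term ≥ 1, where ∸ is exact)
minusOne : Poly → Poly
minusOne p zero = p zero ∸ 1
minusOne p (suc i) = p (suc i)

module _ {m n : ℕ} (c : Cliques m n) where

  candidates : List (Subset m)
  candidates = filter (λ J → ¬? (γ c J ≟ 0)) (allSubsets m)

  familyPoly : List (Subset m) → Poly
  familyPoly F = foldr (λ J p → minusOne (onePlusX ^P γ c J) ⊛ p) pone F

  -- Σ_{F ∈ I_P} ∏_{J ∈ F} [(1+x)^{γ_J} - 1], given a decision procedure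
  -- for being path-intersecting (the result does not depend on which one)
  generatingPoly : Decidable (PathIntersecting {m}) → Poly
  generatingPoly pi? =
    foldr (λ F p → familyPoly F ⊕ p) pzero (filter pi? (sublists candidates))

  -- number of H ⊆ V with |H| = k and U[H] connected, given a decision
  -- procedure for connectivity (the count does not depend on which one)
  connectedCount : Decidable (Connected c) → ℕ → ℕ
  connectedCount conn? k = length (filter P? (allSubsets n))
    where
      P? : Decidable (λ H → SubsetOfV c H × ∣ H ∣ ≡ k × Connected c H)
      P? H = all? (λ v → (v ∈? H) →-dec any? (λ j → v ∈? c j))
             ×-dec (∣ H ∣ Data.Nat.≟ k) ×-dec conn? H

module Submission where

-- Give each vertex v ∈ V its type J = {j : v ∈ c_j}, so that Γ_J is the set of vertices of
-- type J and two distinct vertices are adjacent iff their types intersect. Hence U[H] is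
-- connected iff the family of types met by H is path-intersecting, and the sets H meeting
-- exactly the types in F arise by choosing a nonempty subset of Γ_J for every J ∈ F, which
-- (1+x)^γ_J − 1 counts by size. Instead of partitioning by F we add the vertices one at a
-- time, keeping track of the types already met ("marked"): a marked type contributes
-- (1+x)^γ_J instead of (1+x)^γ_J − 1, and a vertex of type ℓ is either left out or taken,
-- the latter contributing a factor x and marking ℓ.

open import Defs
open import Algebra.Properties.CommutativeSemigroup using (interchange)
open import Data.Bool using (Bool; true; false; T; T?; if_then_else_; _∨_)
open import Data.Bool.Properties using () renaming (_≟_ to _≟ᵇ_)
open import Data.Fin using (Fin; zero; suc) renaming (_≟_ to _≟ᶠ_)
open import Data.Fin.Properties using (all?; any?)
open import Data.Fin.Subset using (Subset; _∈_; ∣_∣)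
open import Data.Fin.Subset.Properties using (_∈?_; x∈p∩q⁺; x∈p∩q⁻)
open import Data.List using (List; []; _∷_; _++_; map; foldr; filter; filterᵇ; length; allFin; tabulate)
open import Data.List.Membership.Propositional using () renaming (_∈_ to _∈ᴸ_)
open import Data.List.Membership.Propositional.Properties
  using (∈-filter⁺; ∈-filter⁻; ∈-allFin; ∈-map⁺; ∈-map⁻; ∈-++⁺ˡ; ∈-++⁺ʳ)
open import Data.List.Properties
  using (filter-++; filter-≐; filter-accept; filter-reject; filter-none; length-++; length-map; map-tabulate)
open import Data.List.Relation.Unary.All as All using (All; []; _∷_)
open import Data.List.Relation.Unary.AllPairs using ([]; _∷_)
open import Data.List.Relation.Unary.Any using (here; there)
open import Data.List.Relation.Unary.Unique.Propositional using (Unique)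
import Data.List.Relation.Unary.Unique.Propositional.Properties as Unique
open import Data.Nat using (ℕ; zero; suc; _+_; _*_; _∸_; _≤_; z≤n; _≥_) renaming (_≟_ to _≟ℕ_)
open import Data.Nat.Properties
  using (≤-refl; m≤n⇒m≤1+n; +-assoc; +-comm; +-identityʳ; +-commutativeSemigroup; *-zeroʳ;
         *-distribˡ-+; *-distribʳ-+; +-∸-assoc; n∸n≡0; suc-injective)
open import Data.Product using (_×_; _,_; proj₁; proj₂; ∃-syntax)
open import Data.Sum using (_⊎_; inj₁; inj₂)
open import Data.Vec using ([]; _∷_; here; there)
import Data.Vec.Properties as Vec
open import Function using (_∘_)
open import Level using (0ℓ)
open import Relation.Binary.Bundles using (Setoid)
open import Relation.Binary.Definitions using (DecidableEquality)
open import Relation.Binary.PropositionalEquality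
import Relation.Binary.Reasoning.Setoid as SetoidReasoning
open import Relation.Nullary using (¬_; Dec; does; yes; no)
open import Relation.Nullary.Decidable using (_×-dec_; _→-dec_; ¬?; dec-true; dec-false)
open import Relation.Unary using (Pred; Decidable; _≐_)

module PolyReasoning = SetoidReasoning (ℕ →-setoid ℕ)
open Setoid (ℕ →-setoid ℕ) using () renaming (sym to ≗-sym; trans to ≗-trans)

shift : Poly → Poly
shift p zero = 0
shift p (suc i) = p i

sumTo-cong : ∀ k {f g : ℕ → ℕ} → (∀ {i} → i ≤ k → f i ≡ g i) → sumTo k f ≡ sumTo k g
sumTo-cong zero f≡g = f≡g z≤n
sumTo-cong (suc k) f≡g = cong₂ _+_ (sumTo-cong k (f≡g ∘ m≤n⇒m≤1+n)) (f≡g ≤-refl)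

sumTo-+ : ∀ k (f g : ℕ → ℕ) → sumTo k (λ i → f i + g i) ≡ sumTo k f + sumTo k g
sumTo-+ zero f g = refl
sumTo-+ (suc k) f g = trans (cong (_+ (f (suc k) + g (suc k))) (sumTo-+ k f g))
  (interchange +-commutativeSemigroup (sumTo k f) (sumTo k g) (f (suc k)) (g (suc k)))

sumTo-zero : ∀ k {f : ℕ → ℕ} → (∀ i → f i ≡ 0) → sumTo k f ≡ 0
sumTo-zero zero f≡0 = f≡0 zero
sumTo-zero (suc k) f≡0 = cong₂ _+_ (sumTo-zero k f≡0) (f≡0 (suc k))

sumTo-sucˡ : ∀ k (f : ℕ → ℕ) → sumTo (suc k) f ≡ f 0 + sumTo k (f ∘ suc)
sumTo-sucˡ zero f = refl
sumTo-sucˡ (suc k) f = trans (cong (_+ f (suc (suc k))) (sumTo-sucˡ k f))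
  (+-assoc (f 0) (sumTo k (f ∘ suc)) (f (suc (suc k))))

⊕-cong : ∀ {p p′ q q′} → p ≗ p′ → q ≗ q′ → (p ⊕ q) ≗ (p′ ⊕ q′)
⊕-cong p≗p′ q≗q′ i = cong₂ _+_ (p≗p′ i) (q≗q′ i)

⊕-congˡ : ∀ p {q q′} → q ≗ q′ → (p ⊕ q) ≗ (p ⊕ q′)
⊕-congˡ p = ⊕-cong {p} {p} (λ _ → refl)

⊕-identityʳ : ∀ p → (p ⊕ pzero) ≗ p
⊕-identityʳ p i = +-identityʳ (p i)

⊛-cong : ∀ {p p′ q q′} → p ≗ p′ → q ≗ q′ → (p ⊛ q) ≗ (p′ ⊛ q′)
⊛-cong p≗p′ q≗q′ k = sumTo-cong k (λ {i} _ → cong₂ _*_ (p≗p′ i) (q≗q′ (k ∸ i)))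

⊛-congˡ : ∀ p {q q′} → q ≗ q′ → (p ⊛ q) ≗ (p ⊛ q′)
⊛-congˡ p = ⊛-cong {p} {p} (λ _ → refl)

⊛-congʳ : ∀ {p p′} q → p ≗ p′ → (p ⊛ q) ≗ (p′ ⊛ q)
⊛-congʳ q p≗p′ = ⊛-cong {q = q} p≗p′ (λ _ → refl)

⊛-distribˡ-⊕ : ∀ p q r → (p ⊛ (q ⊕ r)) ≗ ((p ⊛ q) ⊕ (p ⊛ r))
⊛-distribˡ-⊕ p q r k =
  trans (sumTo-cong k (λ {i} _ → *-distribˡ-+ (p i) (q (k ∸ i)) (r (k ∸ i)))) (sumTo-+ k _ _)

⊛-distribʳ-⊕ : ∀ p q r → ((p ⊕ q) ⊛ r) ≗ ((p ⊛ r) ⊕ (q ⊛ r))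
⊛-distribʳ-⊕ p q r k =
  trans (sumTo-cong k (λ {i} _ → *-distribʳ-+ (r (k ∸ i)) (p i) (q i))) (sumTo-+ k _ _)

⊛-zeroˡ : ∀ p → (pzero ⊛ p) ≗ pzero
⊛-zeroˡ p k = sumTo-zero k (λ _ → refl)

⊛-zeroʳ : ∀ p → (p ⊛ pzero) ≗ pzero
⊛-zeroʳ p k = sumTo-zero k (λ i → *-zeroʳ (p i))

⊛-identityˡ : ∀ p → (pone ⊛ p) ≗ p
⊛-identityˡ p zero = +-identityʳ (p 0)
⊛-identityˡ p (suc k) = begin
  sumTo (suc k) (λ i → pone i * p (suc k ∸ i))  ≡⟨ sumTo-sucˡ k _ ⟩
  (p (suc k) + 0) + sumTo k (λ _ → 0)
    ≡⟨ cong₂ _+_ (+-identityʳ _) (sumTo-zero k (λ _ → refl)) ⟩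
  p (suc k) + 0                                 ≡⟨ +-identityʳ _ ⟩
  p (suc k)                                     ∎
  where open ≡-Reasoning

shift-cong : ∀ {p q} → p ≗ q → shift p ≗ shift q
shift-cong p≗q zero = refl
shift-cong p≗q (suc i) = p≗q i

shift-⊕ : ∀ p q → shift (p ⊕ q) ≗ (shift p ⊕ shift q)
shift-⊕ p q zero = refl
shift-⊕ p q (suc i) = refl

shift-⊛ : ∀ p q → (shift p ⊛ q) ≗ shift (p ⊛ q)
shift-⊛ p q zero = refl
shift-⊛ p q (suc k) = sumTo-sucˡ k _

⊛-shift : ∀ p q → (p ⊛ shift q) ≗ shift (p ⊛ q)
⊛-shift p q zero = *-zeroʳ (p 0)
⊛-shift p q (suc k) = begin
  sumTo k (λ i → p i * shift q (suc k ∸ i)) + p (suc k) * shift q (suc k ∸ suc k)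
    ≡⟨ cong₂ _+_ (sumTo-cong k (λ {i} i≤k → cong (λ j → p i * shift q j) (+-∸-assoc 1 i≤k)))
                 (cong (λ j → p (suc k) * shift q j) (n∸n≡0 (suc k))) ⟩
  sumTo k (λ i → p i * q (k ∸ i)) + p (suc k) * 0
    ≡⟨ cong (sumTo k (λ i → p i * q (k ∸ i)) +_) (*-zeroʳ (p (suc k))) ⟩
  sumTo k (λ i → p i * q (k ∸ i)) + 0
    ≡⟨ +-identityʳ _ ⟩
  sumTo k (λ i → p i * q (k ∸ i))
    ∎
  where open ≡-Reasoning

onePlusX-⊛ : ∀ p → (onePlusX ⊛ p) ≗ (p ⊕ shift p)
onePlusX-⊛ p zero = refl
onePlusX-⊛ p (suc zero) = cong₂ _+_ (+-identityʳ (p 1)) (+-identityʳ (p 0))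
onePlusX-⊛ p (suc (suc k)) = begin
  sumTo (suc (suc k)) (λ i → onePlusX i * p (suc (suc k) ∸ i))
    ≡⟨ sumTo-sucˡ (suc k) _ ⟩
  (p (suc (suc k)) + 0) + sumTo (suc k) (λ i → onePlusX (suc i) * p (suc k ∸ i))
    ≡⟨ cong₂ _+_ (+-identityʳ (p (suc (suc k)))) (sumTo-sucˡ k _) ⟩
  p (suc (suc k)) + ((p (suc k) + 0) + sumTo k (λ _ → 0))
    ≡⟨ cong (λ t → p (suc (suc k)) + t)
         (cong₂ _+_ (+-identityʳ _) (sumTo-zero k (λ _ → refl))) ⟩
  p (suc (suc k)) + (p (suc k) + 0)
    ≡⟨ cong (p (suc (suc k)) +_) (+-identityʳ _) ⟩
  p (suc (suc k)) + p (suc k)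
    ∎
  where open ≡-Reasoning

split-⊛ : ∀ {g g₀ g₁} X → g ≗ (g₀ ⊕ shift g₁) →
          (g ⊛ X) ≗ ((g₀ ⊛ X) ⊕ shift (g₁ ⊛ X))
split-⊛ {g} {g₀} {g₁} X g≗ = begin
  g ⊛ X                              ≈⟨ ⊛-congʳ X g≗ ⟩
  (g₀ ⊕ shift g₁) ⊛ X                ≈⟨ ⊛-distribʳ-⊕ g₀ (shift g₁) X ⟩
  (g₀ ⊛ X) ⊕ (shift g₁ ⊛ X)          ≈⟨ ⊕-congˡ (g₀ ⊛ X) (shift-⊛ g₁ X) ⟩
  (g₀ ⊛ X) ⊕ shift (g₁ ⊛ X)          ∎
  where open PolyReasoning

⊛-split : ∀ g {X X₀ X₁} → X ≗ (X₀ ⊕ shift X₁) →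
          (g ⊛ X) ≗ ((g ⊛ X₀) ⊕ shift (g ⊛ X₁))
⊛-split g {X} {X₀} {X₁} X≗ = begin
  g ⊛ X                              ≈⟨ ⊛-congˡ g X≗ ⟩
  g ⊛ (X₀ ⊕ shift X₁)                ≈⟨ ⊛-distribˡ-⊕ g X₀ (shift X₁) ⟩
  (g ⊛ X₀) ⊕ (g ⊛ shift X₁)          ≈⟨ ⊕-congˡ (g ⊛ X₀) (⊛-shift g X₁) ⟩
  (g ⊛ X₀) ⊕ shift (g ⊛ X₁)          ∎
  where open PolyReasoning

⊕-shift-interchange : ∀ p q r s → ((p ⊕ shift r) ⊕ (q ⊕ shift s)) ≗ ((p ⊕ q) ⊕ shift (r ⊕ s))
⊕-shift-interchange p q r s i =
  trans (interchange +-commutativeSemigroup (p i) (shift r i) (q i) (shift s i))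
        (cong (p i + q i +_) (sym (shift-⊕ r s i)))

filter-map : ∀ {A B : Set} {P : B → Set} (P? : Decidable P) (f : A → B) xs →
             filter P? (map f xs) ≡ map f (filter (λ x → P? (f x)) xs)
filter-map P? f [] = refl
filter-map P? f (x ∷ xs) with does (P? (f x))
... | true = cong (f x ∷_) (filter-map P? f xs)
... | false = filter-map P? f xs

length-filter-accept : ∀ {A : Set} {P : A → Set} (P? : Decidable P) {x} xs → P x →
                       length (filter P? (x ∷ xs)) ≡ suc (length (filter P? xs))
length-filter-accept P? xs px = cong length (filter-accept P? px)

length-filter-reject : ∀ {A : Set} {P : A → Set} (P? : Decidable P) {x} xs → ¬ P x →
                       length (filter P? (x ∷ xs)) ≡ length (filter P? xs)
length-filter-reject P? xs ¬px = cong length (filter-reject P? ¬px)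

length-filter-map : ∀ {A B : Set} {P : B → Set} (P? : Decidable P) (f : A → B) xs →
                    length (filter P? (map f xs)) ≡ length (filter (λ x → P? (f x)) xs)
length-filter-map P? f xs =
  trans (cong length (filter-map P? f xs)) (length-map f (filter (λ x → P? (f x)) xs))

length-filter-allSubsets : ∀ {n} {Q : Subset (suc n) → Set} (Q? : Decidable Q) →
  length (filter Q? (allSubsets (suc n)))
    ≡ length (filter (λ H → Q? (true ∷ H)) (allSubsets n))
      + length (filter (λ H → Q? (false ∷ H)) (allSubsets n))
length-filter-allSubsets {n} Q? = begin
  length (filter Q? (map (true ∷_) S ++ map (false ∷_) S))
    ≡⟨ cong length (filter-++ Q? (map (true ∷_) S) (map (false ∷_) S)) ⟩
  length (filter Q? (map (true ∷_) S) ++ filter Q? (map (false ∷_) S))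
    ≡⟨ length-++ (filter Q? (map (true ∷_) S)) ⟩
  length (filter Q? (map (true ∷_) S)) + length (filter Q? (map (false ∷_) S))
    ≡⟨ cong₂ _+_ (countMap true) (countMap false) ⟩
  length (filter (λ H → Q? (true ∷ H)) S) + length (filter (λ H → Q? (false ∷ H)) S)
    ∎
  where
    open ≡-Reasoning
    S = allSubsets n
    countMap : ∀ x → length (filter Q? (map (x ∷_) S)) ≡ length (filter (λ H → Q? (x ∷ H)) S)
    countMap x = length-filter-map Q? (x ∷_) S

module _ {n} {Q : Fin (suc n) → Set} (Q? : Decidable Q) where

  private
    countTail : length (filter Q? (tabulate suc)) ≡ length (filter (Q? ∘ suc) (allFin n))
    countTail = trans (cong (length ∘ filter Q?) (sym (map-tabulate (λ v → v) suc)))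
                      (length-filter-map Q? suc (allFin n))

  length-filter-allFin-accept : Q zero →
    length (filter Q? (allFin (suc n))) ≡ suc (length (filter (Q? ∘ suc) (allFin n)))
  length-filter-allFin-accept q₀ = trans (length-filter-accept Q? (tabulate suc) q₀) (cong suc countTail)

  length-filter-allFin-reject : ¬ Q zero →
    length (filter Q? (allFin (suc n))) ≡ length (filter (Q? ∘ suc) (allFin n))
  length-filter-allFin-reject ¬q₀ = trans (length-filter-reject Q? (tabulate suc) ¬q₀) countTail

indicator : ∀ {X : Set} → Dec X → Poly
indicator d = if does d then pone else pzero

indicator-suc : ∀ {X : Set} (d : Dec X) k → indicator d (suc k) ≡ 0
indicator-suc (yes _) k = refl
indicator-suc (no _) k = refl

inWeight : Bool → ℕ → Poly
inWeight true a = onePlusX ^P a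
inWeight false a = minusOne (onePlusX ^P a)

outWeight : Bool → Poly
outWeight true = pzero
outWeight false = pone

inWeight-suc : ∀ β a → inWeight β (suc a) ≗ (inWeight β a ⊕ shift (inWeight true a))
inWeight-suc true a = onePlusX-⊛ (onePlusX ^P a)
inWeight-suc false a zero =
  trans (cong (_∸ 1) (+-identityʳ ((onePlusX ^P a) 0))) (sym (+-identityʳ _))
inWeight-suc false a (suc i) = onePlusX-⊛ (onePlusX ^P a) (suc i)

outWeight-split : ∀ β → outWeight β ≗ (outWeight β ⊕ shift (outWeight true))
outWeight-split β zero = sym (+-identityʳ _)
outWeight-split β (suc i) = sym (+-identityʳ _)

module _ {A : Set} where

  -- Σ over sublists F of Ls with P F of ∏_{J ∈ F} inWeight (b J) (a J) · ∏_{J ∉ F} outWeight (b J):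
  -- the size generating function of choosing a subset of the a J elements of each type J,
  -- where F consists of the types chosen or marked (b J).
  markedSum : List A → (A → ℕ) → (A → Bool) → {P : List A → Set} → Decidable P → Poly
  markedSum [] a b P? = indicator (P? [])
  markedSum (J ∷ Ls) a b P? =
    (inWeight (b J) (a J) ⊛ markedSum Ls a b (λ F → P? (J ∷ F)))
      ⊕ (outWeight (b J) ⊛ markedSum Ls a b P?)

  markedSum-cong : ∀ Ls {a a′ b b′} → All (λ J → a J ≡ a′ J) Ls → All (λ J → b J ≡ b′ J) Ls →
                   ∀ {P} (P? : Decidable P) → markedSum Ls a b P? ≗ markedSum Ls a′ b′ P?
  markedSum-cong [] [] [] P? = λ _ → refl
  markedSum-cong (J ∷ Ls) (aJ ∷ as) (bJ ∷ bs) P? = ⊕-cong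
    (⊛-cong (cong-app (cong₂ inWeight bJ aJ)) (markedSum-cong Ls as bs (λ F → P? (J ∷ F))))
    (⊛-cong (cong-app (cong outWeight bJ)) (markedSum-cong Ls as bs P?))

  markedSum-uncounted : ∀ Ls b {P} (P? : Decidable P) →
                        markedSum Ls (λ _ → 0) b P? ≗ indicator (P? (filterᵇ b Ls))
  markedSum-uncounted [] b P? = λ _ → refl
  markedSum-uncounted (J ∷ Ls) b P? with b J
  ... | true = begin
    (pone ⊛ T₁) ⊕ (pzero ⊛ T₂)   ≈⟨ ⊕-cong (⊛-identityˡ T₁) (⊛-zeroˡ T₂) ⟩
    T₁ ⊕ pzero                   ≈⟨ ⊕-identityʳ T₁ ⟩
    T₁                           ≈⟨ markedSum-uncounted Ls b (λ F → P? (J ∷ F)) ⟩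
    indicator (P? (J ∷ filterᵇ b Ls)) ∎
    where
      open PolyReasoning
      T₁ = markedSum Ls (λ _ → 0) b (λ F → P? (J ∷ F))
      T₂ = markedSum Ls (λ _ → 0) b P?
  ... | false = begin
    (minusOne pone ⊛ T₁) ⊕ (pone ⊛ T₂)
      ≈⟨ ⊕-cong (⊛-congʳ T₁ minusOne-pone) (⊛-identityˡ T₂) ⟩
    (pzero ⊛ T₁) ⊕ T₂                    ≈⟨ ⊕-cong (⊛-zeroˡ T₁) (markedSum-uncounted Ls b P?) ⟩
    pzero ⊕ indicator (P? (filterᵇ b Ls)) ∎
    where
      open PolyReasoning
      T₁ = markedSum Ls (λ _ → 0) b (λ F → P? (J ∷ F))
      T₂ = markedSum Ls (λ _ → 0) b P?
      minusOne-pone : minusOne pone ≗ pzero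
      minusOne-pone zero = refl
      minusOne-pone (suc i) = refl

module _ {A : Set} (a : A → ℕ) where

  -- For a = γ c, familyProduct is familyPoly c and familySum of the path-intersecting
  -- sublists of candidates c is generatingPoly c, definitionally.
  familyProduct : List A → Poly
  familyProduct F = foldr (λ J p → inWeight false (a J) ⊛ p) pone F

  familySum : List (List A) → Poly
  familySum Fs = foldr (λ F p → familyProduct F ⊕ p) pzero Fs

  familySum-++ : ∀ Fs Gs → familySum (Fs ++ Gs) ≗ (familySum Fs ⊕ familySum Gs)
  familySum-++ [] Gs i = refl
  familySum-++ (F ∷ Fs) Gs i =
    trans (cong (familyProduct F i +_) (familySum-++ Fs Gs i)) (sym (+-assoc (familyProduct F i) _ _))

  familySum-map-∷ : ∀ J Fs → familySum (map (J ∷_) Fs) ≗ (inWeight false (a J) ⊛ familySum Fs)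
  familySum-map-∷ J [] = ≗-sym (⊛-zeroʳ (inWeight false (a J)))
  familySum-map-∷ J (F ∷ Fs) = ≗-trans (⊕-congˡ (familyProduct (J ∷ F)) (familySum-map-∷ J Fs))
    (≗-sym (⊛-distribˡ-⊕ (inWeight false (a J)) (familyProduct F) (familySum Fs)))

  familySum-sublists : ∀ Ls {P} (P? : Decidable P) →
                       familySum (filter P? (sublists Ls)) ≗ markedSum Ls a (λ _ → false) P?
  familySum-sublists [] P? with does (P? [])
  ... | true = ⊕-identityʳ pone
  ... | false = λ _ → refl
  familySum-sublists (J ∷ Ls) P? = begin
    familySum (filter P? (map (J ∷_) S ++ S))
      ≡⟨ cong familySum (filter-++ P? (map (J ∷_) S) S) ⟩
    familySum (filter P? (map (J ∷_) S) ++ filter P? S)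
      ≈⟨ familySum-++ (filter P? (map (J ∷_) S)) (filter P? S) ⟩
    familySum (filter P? (map (J ∷_) S)) ⊕ familySum (filter P? S)
      ≡⟨ cong (λ Fs → familySum Fs ⊕ familySum (filter P? S)) (filter-map P? (J ∷_) S) ⟩
    familySum (map (J ∷_) (filter Q? S)) ⊕ familySum (filter P? S)
      ≈⟨ ⊕-cong (familySum-map-∷ J (filter Q? S)) (≗-sym (⊛-identityˡ _)) ⟩
    (inWeight false (a J) ⊛ familySum (filter Q? S)) ⊕ (pone ⊛ familySum (filter P? S))
      ≈⟨ ⊕-cong (⊛-congˡ (inWeight false (a J)) (familySum-sublists Ls Q?))
                (⊛-congˡ pone (familySum-sublists Ls P?)) ⟩
    markedSum (J ∷ Ls) a (λ _ → false) P?
      ∎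
    where
      open PolyReasoning
      S = sublists Ls
      Q? = λ F → P? (J ∷ F)

module _ {A : Set} (_≟_ : DecidableEquality A) where

  mark : A → (A → Bool) → A → Bool
  mark ℓ b J = does (ℓ ≟ J) ∨ b J

  mark-self : ∀ ℓ b → mark ℓ b ℓ ≡ true
  mark-self ℓ b = cong (_∨ b ℓ) (dec-true (ℓ ≟ ℓ) refl)

  mark-other : ∀ {ℓ J} b → ℓ ≢ J → mark ℓ b J ≡ b J
  mark-other {ℓ} {J} b ℓ≢J = cong (_∨ b J) (dec-false (ℓ ≟ J) ℓ≢J)

  markedSum-step : ∀ {ℓ} Ls → Unique Ls → ℓ ∈ᴸ Ls →
                   ∀ {a a′} → a′ ℓ ≡ suc (a ℓ) → (∀ {J} → ℓ ≢ J → a′ J ≡ a J) →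
                   ∀ b {P} (P? : Decidable P) →
                   markedSum Ls a′ b P? ≗ (markedSum Ls a b P? ⊕ shift (markedSum Ls a (mark ℓ b) P?))
  markedSum-step {ℓ} (ℓ ∷ Ls) (ℓ≢Ls ∷ _) (here refl) {a} {a′} a′ℓ a′≡a b P? = begin
    (inWeight (b ℓ) (a′ ℓ) ⊛ markedSum Ls a′ b Q?) ⊕ (gₒ ⊛ markedSum Ls a′ b P?)
      ≈⟨ ⊕-cong (⊛-cong (cong-app (cong (inWeight (b ℓ)) a′ℓ)) (unbumped Q?))
                (⊛-congˡ gₒ (unbumped P?)) ⟩
    (inWeight (b ℓ) (suc (a ℓ)) ⊛ T₁) ⊕ (gₒ ⊛ T₂)
      ≈⟨ ⊕-cong (split-⊛ T₁ (inWeight-suc (b ℓ) (a ℓ))) (split-⊛ T₂ (outWeight-split (b ℓ))) ⟩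
    ((gᵢ ⊛ T₁) ⊕ shift (hᵢ ⊛ T₁)) ⊕ ((gₒ ⊛ T₂) ⊕ shift (hₒ ⊛ T₂))
      ≈⟨ ⊕-shift-interchange (gᵢ ⊛ T₁) (gₒ ⊛ T₂) (hᵢ ⊛ T₁) (hₒ ⊛ T₂) ⟩
    ((gᵢ ⊛ T₁) ⊕ (gₒ ⊛ T₂)) ⊕ shift ((hᵢ ⊛ T₁) ⊕ (hₒ ⊛ T₂))
      ≈˘⟨ ⊕-congˡ ((gᵢ ⊛ T₁) ⊕ (gₒ ⊛ T₂)) (shift-cong marked) ⟩
    markedSum (ℓ ∷ Ls) a b P? ⊕ shift (markedSum (ℓ ∷ Ls) a (mark ℓ b) P?)
      ∎
    where
      open PolyReasoning
      Q? = λ F → P? (ℓ ∷ F)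
      T₁ = markedSum Ls a b Q?
      T₂ = markedSum Ls a b P?
      gᵢ = inWeight (b ℓ) (a ℓ)
      gₒ = outWeight (b ℓ)
      hᵢ = inWeight true (a ℓ)
      hₒ = outWeight true
      unbumped : ∀ {R} (R? : Decidable R) → markedSum Ls a′ b R? ≗ markedSum Ls a b R?
      unbumped = markedSum-cong Ls (All.map a′≡a ℓ≢Ls) (All.universal (λ _ → refl) Ls)
      unmarked : ∀ {R} (R? : Decidable R) → markedSum Ls a (mark ℓ b) R? ≗ markedSum Ls a b R?
      unmarked = markedSum-cong Ls (All.universal (λ _ → refl) Ls) (All.map (mark-other b) ℓ≢Ls)
      marked : markedSum (ℓ ∷ Ls) a (mark ℓ b) P? ≗ ((hᵢ ⊛ T₁) ⊕ (hₒ ⊛ T₂))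
      marked = ⊕-cong (⊛-cong (cong-app (cong (λ β → inWeight β (a ℓ)) (mark-self ℓ b))) (unmarked Q?))
                      (⊛-cong (cong-app (cong outWeight (mark-self ℓ b))) (unmarked P?))
  markedSum-step {ℓ} (J ∷ Ls) (J≢Ls ∷ uniq) (there ℓ∈Ls) {a} {a′} a′ℓ a′≡a b P? = begin
    (inWeight (b J) (a′ J) ⊛ markedSum Ls a′ b Q?) ⊕ (gₒ ⊛ markedSum Ls a′ b P?)
      ≈⟨ ⊕-cong (⊛-cong (cong-app (cong (inWeight (b J)) (a′≡a ℓ≢J))) (recurse Q?))
                (⊛-congˡ gₒ (recurse P?)) ⟩
    (gᵢ ⊛ (T₁ ⊕ shift M₁)) ⊕ (gₒ ⊛ (T₂ ⊕ shift M₂))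
      ≈⟨ ⊕-cong (⊛-split gᵢ {X₀ = T₁} {M₁} (λ _ → refl))
                (⊛-split gₒ {X₀ = T₂} {M₂} (λ _ → refl)) ⟩
    ((gᵢ ⊛ T₁) ⊕ shift (gᵢ ⊛ M₁)) ⊕ ((gₒ ⊛ T₂) ⊕ shift (gₒ ⊛ M₂))
      ≈⟨ ⊕-shift-interchange (gᵢ ⊛ T₁) (gₒ ⊛ T₂) (gᵢ ⊛ M₁) (gₒ ⊛ M₂) ⟩
    ((gᵢ ⊛ T₁) ⊕ (gₒ ⊛ T₂)) ⊕ shift ((gᵢ ⊛ M₁) ⊕ (gₒ ⊛ M₂))
      ≈˘⟨ ⊕-congˡ ((gᵢ ⊛ T₁) ⊕ (gₒ ⊛ T₂)) (shift-cong (⊕-cong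
            (⊛-congʳ M₁ (cong-app (cong (λ β → inWeight β (a J)) (mark-other b ℓ≢J))))
            (⊛-congʳ M₂ (cong-app (cong outWeight (mark-other b ℓ≢J)))))) ⟩
    markedSum (J ∷ Ls) a b P? ⊕ shift (markedSum (J ∷ Ls) a (mark ℓ b) P?)
      ∎
    where
      open PolyReasoning
      ℓ≢J = ≢-sym (All.lookup J≢Ls ℓ∈Ls)
      Q? = λ F → P? (J ∷ F)
      gᵢ = inWeight (b J) (a J)
      gₒ = outWeight (b J)
      T₁ = markedSum Ls a b Q?
      T₂ = markedSum Ls a b P?
      M₁ = markedSum Ls a (mark ℓ b) Q?
      M₂ = markedSum Ls a (mark ℓ b) P?
      recurse : ∀ {R} (R? : Decidable R) →
                markedSum Ls a′ b R? ≗ (markedSum Ls a b R? ⊕ shift (markedSum Ls a (mark ℓ b) R?))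
      recurse = markedSum-step Ls uniq ℓ∈Ls a′ℓ a′≡a b

  mark⁻ : ∀ ℓ b {J} → T (mark ℓ b J) → ℓ ≡ J ⊎ T (b J)
  mark⁻ ℓ b {J} t with ℓ ≟ J
  ... | yes ℓ≡J = inj₁ ℓ≡J
  ... | no _ = inj₂ t

  mark⁺ : ∀ ℓ b {J} → ℓ ≡ J ⊎ T (b J) → T (mark ℓ b J)
  mark⁺ ℓ b (inj₁ refl) = subst T (sym (mark-self ℓ b)) _
  mark⁺ ℓ b {J} (inj₂ t) with ℓ ≟ J
  ... | yes _ = _
  ... | no _ = t

  marksOf : ∀ {n} → (Fin n → A) → Subset n → (A → Bool) → A → Bool
  marksOf {zero} lab [] b = b
  marksOf {suc n} lab (true ∷ H) b = marksOf (λ v → lab (suc v)) H (mark (lab zero) b)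
  marksOf {suc n} lab (false ∷ H) b = marksOf (λ v → lab (suc v)) H b

  marksOf⁻ : ∀ {n} (lab : Fin n → A) H b {J} →
             T (marksOf lab H b J) → T (b J) ⊎ ∃[ v ] v ∈ H × lab v ≡ J
  marksOf⁻ {zero} lab [] b t = inj₁ t
  marksOf⁻ {suc n} lab (false ∷ H) b t with marksOf⁻ (λ v → lab (suc v)) H b t
  ... | inj₁ t′ = inj₁ t′
  ... | inj₂ (v , v∈H , eq) = inj₂ (suc v , there v∈H , eq)
  marksOf⁻ {suc n} lab (true ∷ H) b t with marksOf⁻ (λ v → lab (suc v)) H (mark (lab zero) b) t
  ... | inj₂ (v , v∈H , eq) = inj₂ (suc v , there v∈H , eq)
  ... | inj₁ t′ with mark⁻ (lab zero) b t′
  ...   | inj₁ ℓ≡J = inj₂ (zero , here , ℓ≡J)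
  ...   | inj₂ t″ = inj₁ t″

  marksOf⁺ : ∀ {n} (lab : Fin n → A) H b {J} →
             T (b J) ⊎ ∃[ v ] v ∈ H × lab v ≡ J → T (marksOf lab H b J)
  marksOf⁺ {zero} lab [] b (inj₁ t) = t
  marksOf⁺ {suc n} lab (false ∷ H) b (inj₁ t) = marksOf⁺ (λ v → lab (suc v)) H b (inj₁ t)
  marksOf⁺ {suc n} lab (false ∷ H) b (inj₂ (suc v , there v∈H , eq)) =
    marksOf⁺ (λ v → lab (suc v)) H b (inj₂ (v , v∈H , eq))
  marksOf⁺ {suc n} lab (true ∷ H) b (inj₁ t) =
    marksOf⁺ (λ v → lab (suc v)) H (mark (lab zero) b) (inj₁ (mark⁺ (lab zero) b (inj₂ t)))
  marksOf⁺ {suc n} lab (true ∷ H) b (inj₂ (zero , here , eq)) =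
    marksOf⁺ (λ v → lab (suc v)) H (mark (lab zero) b) (inj₁ (mark⁺ (lab zero) b (inj₁ eq)))
  marksOf⁺ {suc n} lab (true ∷ H) b (inj₂ (suc v , there v∈H , eq)) =
    marksOf⁺ (λ v → lab (suc v)) H (mark (lab zero) b) (inj₂ (v , v∈H , eq))

  labelCount : ∀ n (lab : Fin n → A) {Alive : Pred (Fin n) 0ℓ} → Decidable Alive → A → ℕ
  labelCount n lab alive? J = length (filter (λ v → alive? v ×-dec lab v ≟ J) (allFin n))

  module _ {n} (lab : Fin (suc n) → A) {Alive : Pred (Fin (suc n)) 0ℓ} (alive? : Decidable Alive) where

    labelCount-head : Alive zero →
      labelCount (suc n) lab alive? (lab zero) ≡ suc (labelCount n (lab ∘ suc) (alive? ∘ suc) (lab zero))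
    labelCount-head alive₀ = length-filter-allFin-accept (λ v → alive? v ×-dec lab v ≟ lab zero) (alive₀ , refl)

    labelCount-other : ∀ {J} → lab zero ≢ J →
      labelCount (suc n) lab alive? J ≡ labelCount n (lab ∘ suc) (alive? ∘ suc) J
    labelCount-other {J} ℓ≢J = length-filter-allFin-reject (λ v → alive? v ×-dec lab v ≟ J) (ℓ≢J ∘ proj₂)

    labelCount-dead : ¬ Alive zero → ∀ J →
      labelCount (suc n) lab alive? J ≡ labelCount n (lab ∘ suc) (alive? ∘ suc) J
    labelCount-dead dead J = length-filter-allFin-reject (λ v → alive? v ×-dec lab v ≟ J) (dead ∘ proj₁)

  module _ (Ls : List A) (Ls-unique : Unique Ls) {P : List A → Set} (P? : Decidable P) where

    Admissible : ∀ {n} → (Fin n → A) → Pred (Fin n) 0ℓ → (A → Bool) → ℕ → Pred (Subset n) 0ℓ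
    Admissible lab Alive b k H =
      (∀ v → v ∈ H → Alive v) × ∣ H ∣ ≡ k × P (filterᵇ (marksOf lab H b) Ls)

    admissible? : ∀ {n} (lab : Fin n → A) {Alive} → Decidable Alive →
                  ∀ b k → Decidable (Admissible lab Alive b k)
    admissible? lab alive? b k H =
      all? (λ v → v ∈? H →-dec alive? v) ×-dec ∣ H ∣ ≟ℕ k ×-dec P? (filterᵇ (marksOf lab H b) Ls)

    admissibleCount : ∀ n (lab : Fin n → A) {Alive} → Decidable Alive → (A → Bool) → Poly
    admissibleCount n lab alive? b k = length (filter (admissible? lab alive? b k) (allSubsets n))

    admissibleCount-zero : ∀ (lab : Fin 0 → A) {Alive} (alive? : Decidable Alive) b →
                           admissibleCount 0 lab alive? b ≗ indicator (P? (filterᵇ b Ls))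
    admissibleCount-zero lab alive? b zero = count (P? (filterᵇ b Ls))
      where
        count : (d : Dec (P (filterᵇ b Ls))) → admissibleCount 0 lab alive? b 0 ≡ indicator d 0
        count (yes p) = length-filter-accept (admissible? lab alive? b 0) {[]} [] ((λ ()) , refl , p)
        count (no ¬p) = length-filter-reject (admissible? lab alive? b 0) {[]} [] (¬p ∘ proj₂ ∘ proj₂)
    admissibleCount-zero lab alive? b (suc k) =
      trans (length-filter-reject (admissible? lab alive? b (suc k)) {[]} [] λ { (_ , () , _) })
            (sym (indicator-suc (P? (filterᵇ b Ls)) k))

    module _ {n} (lab : Fin (suc n) → A) {Alive : Pred (Fin (suc n)) 0ℓ} (alive? : Decidable Alive) where

      private
        tailCount : (A → Bool) → Poly
        tailCount = admissibleCount n (lab ∘ suc) (alive? ∘ suc)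

        countWith : Bool → (A → Bool) → ℕ → ℕ
        countWith x b k = length (filter (λ H → admissible? lab alive? b k (x ∷ H)) (allSubsets n))

      admissible-outside : ∀ b k →
        (λ H → Admissible lab Alive b k (false ∷ H)) ≐ Admissible (lab ∘ suc) (Alive ∘ suc) b k
      admissible-outside b k =
        (λ (sub , size , p) → (λ v v∈H → sub (suc v) (there v∈H)) , size , p) ,
        (λ (sub , size , p) → (λ { zero () ; (suc v) (there v∈H) → sub v v∈H }) , size , p)

      admissible-inside : Alive zero → ∀ b k →
        (λ H → Admissible lab Alive b (suc k) (true ∷ H))
          ≐ Admissible (lab ∘ suc) (Alive ∘ suc) (mark (lab zero) b) k
      admissible-inside alive₀ b k =
        (λ (sub , size , p) → (λ v v∈H → sub (suc v) (there v∈H)) , suc-injective size , p) ,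
        (λ (sub , size , p) →
          (λ { zero here → alive₀ ; (suc v) (there v∈H) → sub v v∈H }) , cong suc size , p)

      countWith-false : ∀ b k → countWith false b k ≡ tailCount b k
      countWith-false b k = cong length (filter-≐ _ _ (admissible-outside b k) (allSubsets n))

      countWith-true : Alive zero → ∀ b k → countWith true b k ≡ shift (tailCount (mark (lab zero) b)) k
      countWith-true alive₀ b zero =
        cong length (filter-none _ (All.universal (λ _ → λ { (_ , () , _) }) (allSubsets n)))
      countWith-true alive₀ b (suc k) = cong length (filter-≐ _ _ (admissible-inside alive₀ b k) (allSubsets n))

      countWith-true-dead : ¬ Alive zero → ∀ b k → countWith true b k ≡ 0
      countWith-true-dead dead b k =
        cong length (filter-none _ (All.universal (λ _ (sub , _) → dead (sub zero here)) (allSubsets n)))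

      admissibleCount-suc : Alive zero → ∀ b →
        admissibleCount (suc n) lab alive? b ≗ (tailCount b ⊕ shift (tailCount (mark (lab zero) b)))
      admissibleCount-suc alive₀ b k =
        trans (length-filter-allSubsets (admissible? lab alive? b k))
              (trans (+-comm (countWith true b k) (countWith false b k))
                     (cong₂ _+_ (countWith-false b k) (countWith-true alive₀ b k)))

      admissibleCount-suc-dead : ¬ Alive zero → ∀ b → admissibleCount (suc n) lab alive? b ≗ tailCount b
      admissibleCount-suc-dead dead b k =
        trans (length-filter-allSubsets (admissible? lab alive? b k))
              (cong₂ _+_ (countWith-true-dead dead b k) (countWith-false b k))

    admissibleCount≗markedSum : ∀ n (lab : Fin n → A) {Alive} (alive? : Decidable Alive) →
      (∀ {v} → Alive v → lab v ∈ᴸ Ls) →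
      ∀ b → admissibleCount n lab alive? b ≗ markedSum Ls (labelCount n lab alive?) b P?
    admissibleCount≗markedSum zero lab alive? labelled b =
      ≗-trans (admissibleCount-zero lab alive? b) (≗-sym (markedSum-uncounted Ls b P?))
    admissibleCount≗markedSum (suc n) lab {Alive} alive? labelled b = byFirstVertex (alive? zero)
      where
        open PolyReasoning
        C′ = admissibleCount n (lab ∘ suc) (alive? ∘ suc)
        a′ = labelCount n (lab ∘ suc) (alive? ∘ suc)
        recurse = admissibleCount≗markedSum n (lab ∘ suc) (alive? ∘ suc) labelled

        byFirstVertex : Dec (Alive zero) →
                        admissibleCount (suc n) lab alive? b ≗ markedSum Ls (labelCount (suc n) lab alive?) b P?
        byFirstVertex (yes alive₀) = begin
          admissibleCount (suc n) lab alive? b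
            ≈⟨ admissibleCount-suc lab alive? alive₀ b ⟩
          C′ b ⊕ shift (C′ (mark (lab zero) b))
            ≈⟨ ⊕-cong (recurse b) (shift-cong (recurse (mark (lab zero) b))) ⟩
          markedSum Ls a′ b P? ⊕ shift (markedSum Ls a′ (mark (lab zero) b) P?)
            ≈˘⟨ markedSum-step Ls Ls-unique (labelled alive₀)
                  (labelCount-head lab alive? alive₀) (labelCount-other lab alive?) b P? ⟩
          markedSum Ls (labelCount (suc n) lab alive?) b P?
            ∎
        byFirstVertex (no dead) = begin
          admissibleCount (suc n) lab alive? b
            ≈⟨ admissibleCount-suc-dead lab alive? dead b ⟩
          C′ b
            ≈⟨ recurse b ⟩
          markedSum Ls a′ b P?
            ≈⟨ markedSum-cong Ls (All.universal (sym ∘ labelCount-dead lab alive? dead) Ls)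
                                 (All.universal (λ _ → refl) Ls) P? ⟩
          markedSum Ls (labelCount (suc n) lab alive?) b P?
            ∎

allSubsets-complete : ∀ k (J : Subset k) → J ∈ᴸ allSubsets k
allSubsets-complete zero [] = here refl
allSubsets-complete (suc k) (true ∷ J) = ∈-++⁺ˡ (∈-map⁺ (true ∷_) (allSubsets-complete k J))
allSubsets-complete (suc k) (false ∷ J) =
  ∈-++⁺ʳ (map (true ∷_) (allSubsets k)) (∈-map⁺ (false ∷_) (allSubsets-complete k J))

allSubsets-unique : ∀ k → Unique (allSubsets k)
allSubsets-unique zero = [] ∷ []
allSubsets-unique (suc k) = Unique.++⁺ (tagged true) (tagged false) disjoint
  where
    tagged : ∀ x → Unique (map (x ∷_) (allSubsets k))
    tagged x = Unique.map⁺ Vec.∷-injectiveʳ (allSubsets-unique k)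
    disjoint : ∀ {H} → ¬ (H ∈ᴸ map (true ∷_) (allSubsets k) × H ∈ᴸ map (false ∷_) (allSubsets k))
    disjoint (inTrue , inFalse) with ∈-map⁻ (true ∷_) inTrue | ∈-map⁻ (false ∷_) inFalse
    ... | _ , _ , refl | _ , _ , ()

_≟ˢ_ : ∀ {m} → DecidableEquality (Subset m)
_≟ˢ_ = Vec.≡-dec _≟ᵇ_

chain-head : ∀ {m} {F : List (Subset m)} {A B} → Chain F A B → A ∈ᴸ F
chain-head (single A∈F) = A∈F
chain-head (cons A∈F _ _) = A∈F

module _ {m n : ℕ} (c : Cliques m n) where

  inV? : Decidable (InV c)
  inV? v = any? (λ j → v ∈? c j)

  ∈-membership⁺ : ∀ {v j} → v ∈ c j → j ∈ membership c v
  ∈-membership⁺ {v} {j} v∈cj =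
    Vec.lookup⇒[]= j _ (trans (Vec.lookup∘tabulate _ j) (dec-true (v ∈? c j) v∈cj))

  ∈-membership⁻ : ∀ {v j} → j ∈ membership c v → v ∈ c j
  ∈-membership⁻ {v} {j} j∈ with v ∈? c j | trans (sym (Vec.lookup∘tabulate _ j)) (Vec.[]=⇒lookup j∈)
  ... | yes v∈cj | _ = v∈cj
  ... | no _ | ()

  membership∈candidates : ∀ {v} → InV c v → membership c v ∈ᴸ candidates c
  membership∈candidates {v} v∈V =
    ∈-filter⁺ (λ J → ¬? (γ c J ≟ℕ 0)) (allSubsets-complete m (membership c v)) (nonempty v∈Γ)
    where
      v∈Γ : v ∈ᴸ filter (inΓ? c (membership c v)) (allFin n)
      v∈Γ = ∈-filter⁺ (inΓ? c (membership c v)) (∈-allFin v) (v∈V , refl)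
      nonempty : ∀ {A : Set} {x : A} {xs} → x ∈ᴸ xs → length xs ≢ 0
      nonempty (here _) ()
      nonempty (there _) ()

  candidates-unique : Unique (candidates c)
  candidates-unique = Unique.filter⁺ (λ J → ¬? (γ c J ≟ℕ 0)) (allSubsets-unique m)

  typesMet : Subset n → Subset m → Bool
  typesMet H = marksOf _≟ˢ_ (membership c) H (λ _ → false)

  -- The family {J : Γ_J ∩ H ≠ ∅}; membership c v is the J with v ∈ Γ_J.
  family : Subset n → List (Subset m)
  family H = filterᵇ (typesMet H) (candidates c)

  ∈-family⁺ : ∀ {H v} → SubsetOfV c H → v ∈ H → membership c v ∈ᴸ family H
  ∈-family⁺ {H} {v} H⊆V v∈H =
    ∈-filter⁺ (T? ∘ typesMet H) (membership∈candidates (H⊆V v v∈H))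
      (marksOf⁺ _≟ˢ_ (membership c) H (λ _ → false) (inj₂ (v , v∈H , refl)))

  ∈-family⁻ : ∀ {H J} → J ∈ᴸ family H → ∃[ v ] v ∈ H × membership c v ≡ J
  ∈-family⁻ {H} J∈ with marksOf⁻ _≟ˢ_ (membership c) H (λ _ → false)
                          (proj₂ (∈-filter⁻ (T? ∘ typesMet H) {xs = candidates c} J∈))
  ... | inj₂ witness = witness

  module _ {H : Subset n} (H⊆V : SubsetOfV c H) where

    walk⇒chain : ∀ {u w} → Walk c H u w → Chain (family H) (membership c u) (membership c w)
    walk⇒chain (here u∈H) = single (∈-family⁺ H⊆V u∈H)
    walk⇒chain (step u∈H (_ , j , u∈cj , w∈cj) walk) =
      cons (∈-family⁺ H⊆V u∈H) (j , x∈p∩q⁺ (∈-membership⁺ u∈cj , ∈-membership⁺ w∈cj))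
           (walk⇒chain walk)

    walk-prepend : ∀ {u w v j} → u ∈ H → j ∈ membership c u → j ∈ membership c w →
                   Walk c H w v → Walk c H u v
    walk-prepend {u} {w} {j = j} u∈H j∈u j∈w walk with u ≟ᶠ w
    ... | yes refl = walk
    ... | no u≢w = step u∈H (u≢w , j , ∈-membership⁻ j∈u , ∈-membership⁻ j∈w) walk

    chain⇒walk : ∀ {A B u v} → Chain (family H) A B → u ∈ H → v ∈ H →
                 membership c u ≡ A → membership c v ≡ B → Walk c H u v
    chain⇒walk {u = u} (single _) u∈H v∈H refl same-type with H⊆V u u∈H
    ... | j , u∈cj = walk-prepend u∈H j∈u (subst (j ∈_) (sym same-type) j∈u) (here v∈H)
      where j∈u = ∈-membership⁺ u∈cj
    chain⇒walk (cons {A} {C} _ (j , j∈A∩C) rest) u∈H v∈H refl v-type with ∈-family⁻ (chain-head rest)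
    ... | w , w∈H , refl =
      walk-prepend u∈H (proj₁ j∈A×C) (proj₂ j∈A×C) (chain⇒walk rest w∈H v∈H refl v-type)
      where j∈A×C = x∈p∩q⁻ A C j∈A∩C

    connected⇒pathIntersecting : Connected c H → PathIntersecting (family H)
    connected⇒pathIntersecting conn A B A∈ B∈ with ∈-family⁻ A∈ | ∈-family⁻ B∈
    ... | u , u∈H , refl | v , v∈H , refl = walk⇒chain (conn u v u∈H v∈H)

    pathIntersecting⇒connected : PathIntersecting (family H) → Connected c H
    pathIntersecting⇒connected pi u v u∈H v∈H =
      chain⇒walk (pi _ _ (∈-family⁺ H⊆V u∈H) (∈-family⁺ H⊆V v∈H)) u∈H v∈H refl refl

  connectedCount≡admissibleCount :
    (conn? : Decidable (Connected c)) (pi? : Decidable (PathIntersecting {m})) (k : ℕ) →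
    connectedCount c conn? k
      ≡ admissibleCount _≟ˢ_ (candidates c) candidates-unique pi? n (membership c) inV? (λ _ → false) k
  connectedCount≡admissibleCount conn? pi? k = cong length (filter-≐ _ _ equiv (allSubsets n))
    where
      equiv : (λ H → SubsetOfV c H × ∣ H ∣ ≡ k × Connected c H)
              ≐ Admissible _≟ˢ_ (candidates c) candidates-unique pi? (membership c) (InV c) (λ _ → false) k
      equiv = (λ (H⊆V , size , conn) → H⊆V , size , connected⇒pathIntersecting H⊆V conn) ,
              (λ (H⊆V , size , pi) → H⊆V , size , pathIntersecting⇒connected H⊆V pi)

proposition4p11 : (m n : ℕ) (c : Cliques m n)
    (conn? : Decidable (Connected c))
    (pi? : Decidable (PathIntersecting {m}))
    (k : ℕ) → k ≥ 1 →
    connectedCount c conn? k ≡ generatingPoly c pi? k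
proposition4p11 m n c conn? pi? k _ = begin
  connectedCount c conn? k
    ≡⟨ connectedCount≡admissibleCount c conn? pi? k ⟩
  admissibleCount _≟ˢ_ (candidates c) (candidates-unique c) pi? n (membership c) (inV? c) (λ _ → false) k
    ≡⟨ admissibleCount≗markedSum _≟ˢ_ (candidates c) (candidates-unique c) pi? n (membership c) (inV? c)
         (membership∈candidates c) (λ _ → false) k ⟩
  markedSum (candidates c) (γ c) (λ _ → false) pi? k
    ≡⟨ familySum-sublists (γ c) (candidates c) pi? k ⟨
  generatingPoly c pi? k
    ∎
  where open ≡-Reasoning
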